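{- In any falsifiable Outcome Logic instance, for any outcome assertion $\varphi$ containing no implications and any $m_1,m_2\in M\Sigma$ with $m_1\diamond m_2$ defined: if $m_1\diamond m_2\vDash\varphi$, then there exist outcome assertions $\varphi_1,\varphi_2$ such that $m_1\vDash\varphi_1$, $m_2\vDash\varphi_2$ and $\varphi_1\oplus\varphi_2\Rightarrow\varphi$.
   Context: Execution model $\langle M,\mathsf{bind},\mathsf{unit},\diamond,\varnothing\rangle$: monad on sets with each $\langle MA,\diamond,\varnothing\rangle$ a partial commutative monoid compatible with bind. Outcome assertions over atomic assertions $\mathsf{Prop}$ (relation $\vDash_{\mathsf{atom}}\subseteq M\Sigma\times\mathsf{Prop}$): $\varphi::=\top\mid\bot\mid\top^\oplus\mid\varphi\land\psi\mid\varphi\oplus\psi\mid\varphi\Rightarrow\psi\mid P$; $m\vDash\top$ always, $\bot$ never, $m\vDash\top^\oplus$ iff $m=\varnothing$, $\land$ as usual, $m\vDash\varphi\oplus\psi$ iff $m=m_1\diamond m_2$ with $m_1\vDash\varphi$, $m_2\vDash\psi$, $\Rightarrow$ classical, atomic via $\vDash_{\mathsf{atom}}$. "No implications" means no occurrence of $\Rightarrow$ (negation $\lnot\varphi:=\varphi\Rightarrow\bot$ counts as an implication). $\varphi\Rightarrow\psi$ as a statement means every $m$ satisfying $\varphi$ satisfies $\psi$. The instance is falsifiable if: (1a) $m_1\diamond m_2=\varnothing$ implies $m_1=m_2=\varnothing$; (1b) $m_1\diamond m_2=n_1\diamond n_2$ implies there are $s_1,s_2,t_1,t_2$ with $s_1\diamond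 s_2=n_1$, $t_1\diamond t_2=n_2$, $s_1\diamond t_1=m_1$, $s_2\diamond t_2=m_2$; (2) if $m_1\diamond m_2\vDash P$ for atomic $P$ then there are $\varphi_1,\varphi_2$ with $m_i\vDash\varphi_i$ and $\varphi_1\oplus\varphi_2\Rightarrow P$; (3) $m\not\vDash Q_1\oplus\cdots\oplus Q_n$ iff some implication-free $\psi$ satisfies $m\vDash\psi$ and $\psi\Rightarrow\lnot\bigoplus_jQ_j$; (4) atomic commands $c$ admit trace extrapolation: $[\![c]\!]^\dagger(m)\vDash\psi$ with $\psi$ implication-free implies an implication-free $\varphi$ with $m\vDash\varphi$ and $\vDash\langle\varphi\rangle c\langle\psi\rangle$ (triple validity: $m\vDash\varphi\Rightarrow[\![c]\!]^\dagger(m)\vDash\psi$ for all $m$). -}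

module Defs where

open import Data.Maybe using (Maybe; just; nothing; _>>=_)
open import Data.Product using (Σ; _×_; _,_; ∃; ∃-syntax)
open import Data.Unit using (⊤)
open import Data.Empty using (⊥)
open import Data.List using (List; []; _∷_)
open import Relation.Nullary using (¬_)
open import Relation.Binary.PropositionalEquality using (_≡_)

-- Partiality of ◇ is modelled by a Maybe-valued operation:
-- "m₁ ◇ m₂ = m" means  m₁ ◇ m₂ ≡ just m ; "defined" means it is  just _ .

record ExecutionModel : Set₁ where
  infixl 6 _◇_
  field
    M    : Set → Set
    bind : ∀ {A B : Set} → M A → (A → M B) → M B
    unit : ∀ {A : Set} → A → M A
    _◇_  : ∀ {A : Set} → M A → M A → Maybe (M A)
    ∅    : ∀ {A : Set} → M A
    bind-unitˡ : ∀ {A B : Set} (a : A) (f : A → M B) → bind (unit a) f ≡ f a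
    bind-unitʳ : ∀ {A : Set} (m : M A) → bind m unit ≡ m
    bind-assoc : ∀ {A B C : Set} (m : M A) (f : A → M B) (g : B → M C) →
                 bind (bind m f) g ≡ bind m (λ a → bind (f a) g)
    -- partial commutative monoid laws (Kleene equality on Maybe)
    ◇-comm  : ∀ {A : Set} (m₁ m₂ : M A) → m₁ ◇ m₂ ≡ m₂ ◇ m₁
    ◇-assoc : ∀ {A : Set} (m₁ m₂ m₃ : M A) →
              ((m₁ ◇ m₂) >>= λ m₁₂ → m₁₂ ◇ m₃) ≡ ((m₂ ◇ m₃) >>= λ m₂₃ → m₁ ◇ m₂₃)
    ◇-unit  : ∀ {A : Set} (m : M A) → m ◇ ∅ ≡ just m
    bind-∅  : ∀ {A B : Set} (f : A → M B) → bind ∅ f ≡ ∅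
    bind-◇  : ∀ {A B : Set} (m₁ m₂ m : M A) (f : A → M B) →
              m₁ ◇ m₂ ≡ just m → bind m₁ f ◇ bind m₂ f ≡ just (bind m f)

record OLInstance : Set₁ where
  field
    model : ExecutionModel
  open ExecutionModel model public
  field
    State  : Set
    Prop   : Set
    _⊨atom_ : M State → Prop → Set
    Cmd    : Set
    ⟦_⟧    : Cmd → State → M State

  ⟦_⟧† : Cmd → M State → M State
  ⟦ c ⟧† m = bind m ⟦ c ⟧

module _ (I : OLInstance) where
  open OLInstance I

  infixr 5 _⊕_
  infixr 6 _∧_
  infixr 4 _⇒_

  data Assertion : Set where
    ⊤ₐ   : Assertion
    ⊥ₐ   : Assertion
    ⊤⊕  : Assertion
    _∧_  : Assertion → Assertion → Assertion
    _⊕_  : Assertion → Assertion → Assertion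
    _⇒_  : Assertion → Assertion → Assertion
    atom : Prop → Assertion

  ¬ₐ : Assertion → Assertion
  ¬ₐ φ = φ ⇒ ⊥ₐ

  _⊨_ : M State → Assertion → Set
  m ⊨ ⊤ₐ      = ⊤
  m ⊨ ⊥ₐ      = ⊥
  m ⊨ ⊤⊕     = m ≡ ∅
  m ⊨ (φ ∧ ψ) = (m ⊨ φ) × (m ⊨ ψ)
  m ⊨ (φ ⊕ ψ) = Σ (M State) λ m₁ → Σ (M State) λ m₂ →
                  (m₁ ◇ m₂ ≡ just m) × (m₁ ⊨ φ) × (m₂ ⊨ ψ)
  m ⊨ (φ ⇒ ψ) = m ⊨ φ → m ⊨ ψ
  m ⊨ atom P  = m ⊨atom P

  Entails : Assertion → Assertion → Set
  Entails φ ψ = ∀ m → m ⊨ φ → m ⊨ ψ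

  data NoImp : Assertion → Set where
    ni-⊤  : NoImp ⊤ₐ
    ni-⊥  : NoImp ⊥ₐ
    ni-⊤⊕ : NoImp ⊤⊕
    ni-∧  : ∀ {φ ψ} → NoImp φ → NoImp ψ → NoImp (φ ∧ ψ)
    ni-⊕  : ∀ {φ ψ} → NoImp φ → NoImp ψ → NoImp (φ ⊕ ψ)
    ni-atom : ∀ {P} → NoImp (atom P)

  -- Q₁ ⊕ ⋯ ⊕ Qₙ  (n ≥ 1), given as first atom and list of remaining ones
  ⨁ : Prop → List Prop → Assertion
  ⨁ Q []        = atom Q
  ⨁ Q (Q′ ∷ Qs) = atom Q ⊕ ⨁ Q′ Qs

  ValidTriple : Assertion → Cmd → Assertion → Set
  ValidTriple φ c ψ = ∀ m → m ⊨ φ → ⟦ c ⟧† m ⊨ ψ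

  record Falsifiable : Set where
    field
      ◇-positive : ∀ (m₁ m₂ : M State) → m₁ ◇ m₂ ≡ just ∅ → (m₁ ≡ ∅) × (m₂ ≡ ∅)
      ◇-refine : ∀ (m₁ m₂ n₁ n₂ n : M State) →
                 m₁ ◇ m₂ ≡ just n → n₁ ◇ n₂ ≡ just n →
                 Σ (M State) λ s₁ → Σ (M State) λ s₂ →
                 Σ (M State) λ t₁ → Σ (M State) λ t₂ →
                   (s₁ ◇ s₂ ≡ just n₁) × (t₁ ◇ t₂ ≡ just n₂) ×
                   (s₁ ◇ t₁ ≡ just m₁) × (s₂ ◇ t₂ ≡ just m₂)
      atom-split : ∀ (m₁ m₂ m : M State) (P : Prop) →
                   m₁ ◇ m₂ ≡ just m → m ⊨atom P →
                   Σ Assertion λ φ₁ → Σ Assertion λ φ₂ →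
                     (m₁ ⊨ φ₁) × (m₂ ⊨ φ₂) × Entails (φ₁ ⊕ φ₂) (atom P)
      ⨁-refute : ∀ (m : M State) (Q : Prop) (Qs : List Prop) →
                 (¬ (m ⊨ ⨁ Q Qs) →
                    Σ Assertion λ ψ → NoImp ψ × (m ⊨ ψ) × Entails ψ (¬ₐ (⨁ Q Qs)))
               × ((Σ Assertion λ ψ → NoImp ψ × (m ⊨ ψ) × Entails ψ (¬ₐ (⨁ Q Qs)))
                    → ¬ (m ⊨ ⨁ Q Qs))
      extrapolate : ∀ (c : Cmd) (m : M State) (ψ : Assertion) →
                    NoImp ψ → ⟦ c ⟧† m ⊨ ψ →
                    Σ Assertion λ φ → NoImp φ × (m ⊨ φ) × ValidTriple φ c ψ

-- Atoms split by (2); ⊤⊕ splits into ⊤⊕ ⊕ ⊤⊕ by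
-- positivity (1a); conjunctions split componentwise.  For φ ⊕ ψ the witness m = k₁ ◇ k₂ is
-- refined against m = m₁ ◇ m₂ by (1b) into a 2×2 grid, k₁ and k₂ are split along its rows,
-- and the pieces are regrouped by columns; entailment of the regrouped assertion follows from
-- the interchange law (p ◇ q) ◇ (r ◇ u) = (p ◇ r) ◇ (q ◇ u) of a commutative monoid.
module Submission where

open import Defs
open import Data.Maybe using (Maybe; just; _>>=_)
open import Data.Maybe.Properties using (just-injective)
open import Data.Product using (Σ; ∃-syntax; _×_; _,_)
open import Data.Unit using (tt)
open import Relation.Binary.PropositionalEquality using (_≡_; refl; sym; trans)

>>=-just-inverse : ∀ {A B : Set} (mx : Maybe A) {f : A → Maybe B} {y : B} →
                   (mx >>= f) ≡ just y → ∃[ x ] (mx ≡ just x) × (f x ≡ just y)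
>>=-just-inverse (just x) eq = x , refl , eq

>>=-just : ∀ {A B : Set} {mx : Maybe A} {x : A} (f : A → Maybe B) →
           mx ≡ just x → (mx >>= f) ≡ f x
>>=-just f refl = refl

module PartialMonoid (E : ExecutionModel) {A : Set} where
  open ExecutionModel E

  ◇-comm-just : {a b c : M A} → a ◇ b ≡ just c → b ◇ a ≡ just c
  ◇-comm-just {a} {b} eq = trans (◇-comm b a) eq

  ◇-reassocʳ : {a b c ab n : M A} → a ◇ b ≡ just ab → ab ◇ c ≡ just n →
               ∃[ bc ] (b ◇ c ≡ just bc) × (a ◇ bc ≡ just n)
  ◇-reassocʳ {a} {b} {c} ab-eq n-eq =
    >>=-just-inverse (b ◇ c)
      (trans (sym (◇-assoc a b c)) (trans (>>=-just (λ ab → ab ◇ c) ab-eq) n-eq))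

  ◇-reassocˡ : {a b c bc n : M A} → b ◇ c ≡ just bc → a ◇ bc ≡ just n →
               ∃[ ab ] (a ◇ b ≡ just ab) × (ab ◇ c ≡ just n)
  ◇-reassocˡ {a} {b} {c} bc-eq n-eq =
    >>=-just-inverse (a ◇ b)
      (trans (◇-assoc a b c) (trans (>>=-just (λ bc → a ◇ bc) bc-eq) n-eq))

  ◇-interchange : {p q r u x y n : M A} →
                  p ◇ q ≡ just x → r ◇ u ≡ just y → x ◇ y ≡ just n →
                  ∃[ a ] ∃[ b ] (p ◇ r ≡ just a) × (q ◇ u ≡ just b) × (a ◇ b ≡ just n)
  ◇-interchange pq ru xy
    with w , qy , pw ← ◇-reassocʳ pq xy
    with v , qr , vu ← ◇-reassocˡ ru qy
    with z , pv , zu ← ◇-reassocˡ vu pw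
    with a , pr , aq ← ◇-reassocˡ (◇-comm-just qr) pv
    with b , qu , ab ← ◇-reassocʳ aq zu
    = a , b , pr , qu , ab

module _ (I : OLInstance) where
  open OLInstance I
  open PartialMonoid model

  Splits : M State → M State → Assertion I → Set
  Splits m₁ m₂ φ = ∃[ φ₁ ] ∃[ φ₂ ] (_⊨_ I m₁ φ₁) × (_⊨_ I m₂ φ₂) × Entails I (φ₁ ⊕ φ₂) φ

  ⊤⊕-split-entails : Entails I (⊤⊕ ⊕ ⊤⊕) ⊤⊕
  ⊤⊕-split-entails _ (_ , _ , eq , refl , refl) = just-injective (trans (sym eq) (◇-unit ∅))

  ∧-split-entails : (φ₁ φ₂ ψ₁ ψ₂ φ ψ : Assertion I) →
                    Entails I (φ₁ ⊕ φ₂) φ → Entails I (ψ₁ ⊕ ψ₂) ψ →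
                    Entails I ((φ₁ ∧ ψ₁) ⊕ (φ₂ ∧ ψ₂)) (φ ∧ ψ)
  ∧-split-entails _ _ _ _ _ _ φ-ent ψ-ent n (x , y , xy , (xφ , xψ) , (yφ , yψ)) =
    φ-ent n (x , y , xy , xφ , yφ) , ψ-ent n (x , y , xy , xψ , yψ)

  ⊕-split-entails : (φ₁ φ₂ ψ₁ ψ₂ φ ψ : Assertion I) →
                    Entails I (φ₁ ⊕ φ₂) φ → Entails I (ψ₁ ⊕ ψ₂) ψ →
                    Entails I ((φ₁ ⊕ ψ₁) ⊕ (φ₂ ⊕ ψ₂)) (φ ⊕ ψ)
  ⊕-split-entails _ _ _ _ _ _ φ-ent ψ-ent n (x , y , xy , (p , q , pq , pφ , qψ) , (r , u , ru , rφ , uψ))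
    with a , b , pr , qu , ab ← ◇-interchange pq ru xy
    = a , b , ab , φ-ent a (p , r , pr , pφ , rφ) , ψ-ent b (q , u , qu , qψ , uψ)

  module _ (F : Falsifiable I) where
    open Falsifiable F

    noImp-splits : (φ : Assertion I) → NoImp I φ → {m₁ m₂ m : M State} →
                   m₁ ◇ m₂ ≡ just m → _⊨_ I m φ → Splits m₁ m₂ φ
    noImp-splits ⊤ₐ ni-⊤ _ _ = ⊤ₐ , ⊤ₐ , tt , tt , λ _ _ → tt
    noImp-splits ⊥ₐ ni-⊥ _ ()
    noImp-splits ⊤⊕ ni-⊤⊕ {m₁} {m₂} m-eq refl
      with refl , refl ← ◇-positive m₁ m₂ m-eq
      = ⊤⊕ , ⊤⊕ , refl , refl , ⊤⊕-split-entails
    noImp-splits (φ ∧ ψ) (ni-∧ nφ nψ) m-eq (mφ , mψ)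
      with φ₁ , φ₂ , m₁φ₁ , m₂φ₂ , φ-ent ← noImp-splits φ nφ m-eq mφ
      with ψ₁ , ψ₂ , m₁ψ₁ , m₂ψ₂ , ψ-ent ← noImp-splits ψ nψ m-eq mψ
      = φ₁ ∧ ψ₁ , φ₂ ∧ ψ₂ , (m₁φ₁ , m₁ψ₁) , (m₂φ₂ , m₂ψ₂) , ∧-split-entails φ₁ φ₂ ψ₁ ψ₂ φ ψ φ-ent ψ-ent
    noImp-splits (φ ⊕ ψ) (ni-⊕ nφ nψ) {m₁} {m₂} {m} m-eq (k₁ , k₂ , k-eq , k₁φ , k₂ψ)
      with s₁ , s₂ , t₁ , t₂ , s-eq , t-eq , m₁-eq , m₂-eq ← ◇-refine m₁ m₂ k₁ k₂ m m-eq k-eq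
      with φ₁ , φ₂ , s₁φ₁ , s₂φ₂ , φ-ent ← noImp-splits φ nφ s-eq k₁φ
      with ψ₁ , ψ₂ , t₁ψ₁ , t₂ψ₂ , ψ-ent ← noImp-splits ψ nψ t-eq k₂ψ
      = φ₁ ⊕ ψ₁ , φ₂ ⊕ ψ₂ , (s₁ , t₁ , m₁-eq , s₁φ₁ , t₁ψ₁) , (s₂ , t₂ , m₂-eq , s₂φ₂ , t₂ψ₂)
      , ⊕-split-entails φ₁ φ₂ ψ₁ ψ₂ φ ψ φ-ent ψ-ent
    noImp-splits (atom P) ni-atom {m₁} {m₂} {m} m-eq mP = atom-split m₁ m₂ m P m-eq mP

lemmaD3 : (I : OLInstance) → Falsifiable I →
          (φ : Assertion I) → NoImp I φ →
          (m₁ m₂ m : OLInstance.M I (OLInstance.State I)) →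
          OLInstance._◇_ I m₁ m₂ ≡ just m → _⊨_ I m φ →
          Σ (Assertion I) λ φ₁ → Σ (Assertion I) λ φ₂ →
            (_⊨_ I m₁ φ₁) × (_⊨_ I m₂ φ₂) × Entails I (φ₁ ⊕ φ₂) φ
lemmaD3 I F φ nφ m₁ m₂ m m-eq mφ = noImp-splits I F φ nφ m-eq mφ
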